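{- Consider some node $u$, ready at step $i$ during the execution of a computation under Low Cost Work Stealing. (1) If $u$ gets assigned to a processor at that step, the potential drops by at least $\frac{3}{4}\phi_{i}\left(u\right)$. (2) If $u$ becomes stealable at that step, the potential drops by at least $\frac{3}{4}\phi_{i}\left(u\right)$. (3) If $u$ was already assigned to a processor and gets executed at step $i$, the potential drops by at least $\frac{47}{64}\phi_{i}\left(u\right)$.
   Context: Computation model. A computation is a directed acyclic graph with one root and one sink, every node of out-degree at most $2$; $T_\infty$ is the length of a longest directed path. A node is ready when all its ancestors have been executed. If executing $u$ makes $u'$ ready, $u$ is the designated parent of $u'$; these edges form the enabling tree, $d(u)$ is the depth of $u$ in it and $w(u)=T_\infty-d(u)$ is its weight. Execution proceeds in discrete steps. Low Cost Work Stealing. Each processor owns a split deque (SpDeque) of ready nodes with a private (bottom) part and a public (top) part, an assigned node and a flag targeted. In each scheduling iteration a processor: if targeted is true, moves the topmost node of its private part to the bottom of its public part (if any) and resets targeted; then, if it has an assigned node, executes it, making one enabled node the new assigned node and pushing a second enabled node (if any) onto the bottom of its private part, or, if no node is enabled, taking the bottom node of its private part, else of its public part, as new assigned node; otherwise it picks a uniformly random victim and tries to remove the top node of the victim's public part (setting the victim's targeted flag to true if that part is empty). Potential. A node is stealable if it is stored in the public part of some processor's SpDeque. For a node $u$ ready at step $i$, $\phi_i(u)=4^{3w(u)-2}$ if $u$ is assigned, $4^{3w(u)-1}$ if $u$ is stealable, and $4^{3w(u)}$ otherwise. The potential at step $i$ is $\Phi_i=\sum_{u\in R_i}\phi_i(u)$,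 where $R_i$ is the set of ready nodes at step $i$. -}

module Defs where

open import Data.Nat using (ℕ; zero; suc; _+_; _*_; _∸_; _^_; _≤_)
open import Data.Fin using (Fin) renaming (_≟_ to _≟ᶠ_)
open import Data.Fin.Properties using (any?)
open import Data.List using (List; []; _∷_; _∷ʳ_; length; allFin)
open import Data.List.Membership.Propositional using (_∈_)
import Data.List.Membership.DecPropositional as DecMem
open import Data.List.Relation.Unary.Unique.Propositional using (Unique)
open import Data.List.Relation.Binary.Permutation.Propositional using (_↭_)
open import Data.Maybe using (Maybe; just; nothing)
open import Data.Maybe.Properties using (≡-dec)
open import Data.Bool using (Bool; true; false; if_then_else_)
open import Data.Product using (Σ; ∃; _×_; _,_)
open import Function.Bundles using (_⇔_)
open import Relation.Binary.PropositionalEquality using (_≡_; _≢_)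
open import Relation.Nullary using (¬_; Dec; yes; no)
open import Relation.Nullary.Decidable using (⌊_⌋)

-- Directed paths; the ℕ index is the number of NODES on the path.
data Path {n : ℕ} (Ch : Fin n → List (Fin n)) : Fin n → Fin n → ℕ → Set where
  here : ∀ {u} → Path Ch u u 1
  edge : ∀ {u v w k} → v ∈ Ch u → Path Ch v w k → Path Ch u w (suc k)

Ancestor : ∀ {n} → (Fin n → List (Fin n)) → Fin n → Fin n → Set
Ancestor Ch w v = ∃ λ x → ∃ λ k → x ∈ Ch w × Path Ch x v k

record Computation (n : ℕ) : Set where
  field
    children     : Fin n → List (Fin n)
    outDeg       : ∀ u → length (children u) ≤ 2
    noMultiEdges : ∀ u → Unique (children u)
    acyclic      : ∀ u → ¬ Ancestor children u u
    root         : Fin n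
    sink         : Fin n
    fromRoot     : ∀ u → ∃ λ k → Path children root u k
    toSink       : ∀ u → ∃ λ k → Path children u sink k

open Computation public

IsSpan : ∀ {n} → Computation n → ℕ → Set
IsSpan C T = (∃ λ u → ∃ λ v → Path (children C) u v T)
           × (∀ u v k → Path (children C) u v k → k ≤ T)

Ready : ∀ {n} → Computation n → (Fin n → Bool) → Fin n → Set
Ready C ex v = ex v ≡ false × (∀ w → Ancestor (children C) w v → ex w ≡ true)

-- Scheduler state.  Both parts of the SpDeque are lists whose HEAD is
-- the BOTTOM end (the top is the last element).

record State (n P : ℕ) : Set where
  field
    executed : Fin n → Bool
    dparent  : Fin n → Maybe (Fin n)   -- designated parent (enabling tree)
    depth    : Fin n → ℕ               -- depth in the enabling tree
    priv     : Fin P → List (Fin n)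
    pub      : Fin P → List (Fin n)
    assigned : Fin P → Maybe (Fin n)
    targeted : Fin P → Bool

open State public

upd : ∀ {k} {A : Set} → (Fin k → A) → Fin k → A → Fin k → A
upd f i a j = if ⌊ j ≟ᶠ i ⌋ then a else f j

module _ {n P : ℕ} (C : Computation n) where

  data Retarget (p : Fin P) (s : State n P) : State n P → Set where
    notTargeted : targeted s p ≡ false → Retarget p s s
    targetedEmpty : targeted s p ≡ true → priv s p ≡ [] →
      Retarget p s (record s { targeted = upd (targeted s) p false })
    targetedMove : ∀ xs x → targeted s p ≡ true → priv s p ≡ xs ∷ʳ x →
      Retarget p s (record s { targeted = upd (targeted s) p false
                             ; priv = upd (priv s) p xs
                             ; pub = upd (pub s) p (x ∷ pub s p) })

  exe : State n P → Fin n → State n P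
  exe s u = record s { executed = upd (executed s) u true }

  enable : Fin n → ℕ → Fin n → State n P → State n P
  enable u d v s = record s { dparent = upd (dparent s) v (just u)
                            ; depth = upd (depth s) v d }

  EnabledBy : State n P → Fin n → List (Fin n) → Set
  EnabledBy s u en = Unique en ×
    (∀ v → v ∈ en ⇔ (¬ Ready C (executed s) v × Ready C (executed (exe s u)) v))

  data Act (p : Fin P) (s : State n P) : State n P → Set where
    execNonePriv : ∀ u x xs → assigned s p ≡ just u → EnabledBy s u [] →
      priv s p ≡ x ∷ xs →
      Act p s (record (exe s u) { assigned = upd (assigned s) p (just x)
                                ; priv = upd (priv s) p xs })
    execNonePub : ∀ u x xs → assigned s p ≡ just u → EnabledBy s u [] →
      priv s p ≡ [] → pub s p ≡ x ∷ xs →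
      Act p s (record (exe s u) { assigned = upd (assigned s) p (just x)
                                ; pub = upd (pub s) p xs })
    execNoneIdle : ∀ u → assigned s p ≡ just u → EnabledBy s u [] →
      priv s p ≡ [] → pub s p ≡ [] →
      Act p s (record (exe s u) { assigned = upd (assigned s) p nothing })
    execOne : ∀ u v → assigned s p ≡ just u → EnabledBy s u (v ∷ []) →
      Act p s (record (enable u (suc (depth s u)) v (exe s u))
                 { assigned = upd (assigned s) p (just v) })
    execTwo : ∀ u v₁ v₂ → assigned s p ≡ just u → EnabledBy s u (v₁ ∷ v₂ ∷ []) →
      Act p s (record (enable u (suc (depth s u)) v₂
                        (enable u (suc (depth s u)) v₁ (exe s u)))
                 { assigned = upd (assigned s) p (just v₁)
                 ; priv = upd (priv s) p (v₂ ∷ priv s p) })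
    stealOk : ∀ (q : Fin P) xs x → assigned s p ≡ nothing → pub s q ≡ xs ∷ʳ x →
      Act p s (record s { pub = upd (pub s) q xs
                        ; assigned = upd (assigned s) p (just x) })
    stealFail : ∀ (q : Fin P) → assigned s p ≡ nothing → pub s q ≡ [] →
      Act p s (record s { targeted = upd (targeted s) q true })

  Iter : Fin P → State n P → State n P → Set
  Iter p s s' = ∃ λ s₁ → Retarget p s s₁ × Act p s₁ s'

  data Iters : List (Fin P) → State n P → State n P → Set where
    done : ∀ {s} → Iters [] s s
    next : ∀ {p ps s s₁ s₂} → Iter p s s₁ → Iters ps s₁ s₂ → Iters (p ∷ ps) s s₂

  -- one step: every processor performs exactly one iteration, the
  -- (atomic) iterations being linearised in an arbitrary order
  Step : State n P → State n P → Set
  Step s s' = ∃ λ ps → ps ↭ allFin P × Iters ps s s'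

  Initial : State n P → Set
  Initial s = Σ (Fin P) λ p₀ →
      (∀ v → executed s v ≡ false)
    × (∀ v → dparent s v ≡ nothing)
    × depth s (root C) ≡ 0
    × (∀ q → priv s q ≡ [])
    × (∀ q → pub s q ≡ [])
    × (∀ q → targeted s q ≡ false)
    × assigned s p₀ ≡ just (root C)
    × (∀ q → q ≢ p₀ → assigned s q ≡ nothing)

  data Reachable : State n P → Set where
    init : ∀ {s} → Initial s → Reachable s
    step : ∀ {s s'} → Reachable s → Step s s' → Reachable s'

Assigned : ∀ {n P} → State n P → Fin n → Set
Assigned s u = ∃ λ p → assigned s p ≡ just u

Stealable : ∀ {n P} → State n P → Fin n → Set
Stealable s u = ∃ λ p → u ∈ pub s p

assigned? : ∀ {n P} (s : State n P) (u : Fin n) → Dec (Assigned s u)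
assigned? s u = any? (λ p → ≡-dec _≟ᶠ_ (assigned s p) (just u))

stealable? : ∀ {n P} (s : State n P) (u : Fin n) → Dec (Stealable s u)
stealable? {n} s u = any? (λ p → DecMem._∈?_ (_≟ᶠ_ {n}) u (pub s p))

weight : ∀ {n P} → ℕ → State n P → Fin n → ℕ
weight T s u = T ∸ depth s u

phi : ∀ {n P} → ℕ → State n P → Fin n → ℕ
phi T s u with assigned? s u | stealable? s u
... | yes _ | _     = 4 ^ (3 * weight T s u ∸ 2)
... | no _  | yes _ = 4 ^ (3 * weight T s u ∸ 1)
... | no _  | no _  = 4 ^ (3 * weight T s u)

module Submission where

-- The argument has three parts.  (i) An invariant Inv of reachable states:
-- the nodes held by the processors (assigned node, private and public part)
-- are pairwise distinct and ready, designated parents are executed, and each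
-- ready node has a root path longer than its depth, so that a ready node has
-- positive weight T∞ ∸ depth.  Inv is preserved because every action either
-- executes an assigned node, replacing it by the nodes it enables
-- (Execution), or only moves held nodes around (Bookkeeping).  (ii) Three
-- properties carried through the iterations of a step (via `preserved`): a
-- ready node keeps its depth, an assigned node stays assigned until it is
-- executed, and an executed node's ready children have depth one more and
-- consist of at most one assigned node and one other node.  (iii) The
-- arithmetic of the potential levels 4^(3w∸2) < 4^(3w∸1) < 4^(3w), which
-- turns these facts into the three bounds (module Drops).

open import Defs
open import Data.Nat using (ℕ; zero; suc; _+_; _*_; _∸_; _^_; _≤_; z≤n; s≤s; _≤?_)
open import Data.Nat.Properties
  using ( ≤-trans; ≤-refl; ≤-reflexive; +-comm; +-mono-≤; +-monoʳ-≤; *-monoʳ-≤; *-monoˡ-≤; m≤m+n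
        ; *-suc; ^-monoʳ-≤; m∸n≤m; ∸-monoʳ-≤; module ≤-Reasoning)
open import Data.Nat.Tactic.RingSolver using (solve-∀)
open import Data.Nat.ListAction using (sum)
open import Data.Fin using (Fin) renaming (zero to fzero; suc to fsuc; _≟_ to _≟ᶠ_)
open import Data.Fin.Properties using (suc-injective)
open import Data.List using (List; []; _∷_; _++_; [_]; _∷ʳ_; map; fromMaybe)
open import Data.List.Properties using (++-assoc)
open import Data.List.Membership.Propositional using (_∈_; _∉_)
open import Data.List.Membership.Propositional.Properties using (∈-++⁺ˡ; ∈-++⁺ʳ)
import Data.List.Membership.DecPropositional as DecMembership
open import Data.List.Relation.Unary.Any using (here; there)
open import Data.List.Relation.Unary.All using (All; []; _∷_)
import Data.List.Relation.Unary.All as All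
import Data.List.Relation.Unary.All.Properties as AllProps
open import Data.List.Relation.Unary.AllPairs using ([]; _∷_)
import Data.List.Relation.Unary.AllPairs as AllPairs
open import Data.List.Relation.Unary.Unique.Propositional using (Unique)
import Data.List.Relation.Unary.Unique.Propositional.Properties as UniqueProps
open import Data.List.Relation.Binary.Disjoint.Propositional using (Disjoint)
open import Data.List.Relation.Binary.Permutation.Propositional
  using (_↭_; prep; ↭-refl; ↭-sym; ↭-trans; ↭-reflexive; ↭⇒↭ₛ; module PermutationReasoning)
open import Data.List.Relation.Binary.Permutation.Propositional.Properties
  using (++⁺ʳ; ++⁺ˡ; ∷↭∷ʳ; All-resp-↭; shifts)
import Data.List.Relation.Binary.Permutation.Setoid.Properties as PermutationSetoid
open import Data.Maybe using (Maybe; just; nothing)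
open import Data.Maybe.Properties using (just-injective)
open import Data.Bool using (Bool; true; false) renaming (_≟_ to _≟ᵇ_)
open import Data.Sum using (_⊎_; inj₁; inj₂)
open import Data.Product using (Σ; ∃; _×_; _,_; proj₁; proj₂)
open import Data.Empty using (⊥; ⊥-elim)
open import Function.Bundles using (_⇔_; Equivalence)
open import Relation.Binary.PropositionalEquality hiding ([_])
open import Relation.Nullary using (¬_; Dec; yes; no)
open import Relation.Nullary.Decidable using (decidable-stable)
open import Relation.Nullary.Negation using (¬¬-map)

upd-eq : ∀ {k} {A : Set} (f : Fin k → A) i a → upd f i a i ≡ a
upd-eq f i a with i ≟ᶠ i
... | yes _ = refl
... | no i≢i = ⊥-elim (i≢i refl)

upd-neq : ∀ {k} {A : Set} (f : Fin k → A) i a j → j ≢ i → upd f i a j ≡ f j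
upd-neq f i a j j≢i with j ≟ᶠ i
... | yes j≡i = ⊥-elim (j≢i j≡i)
... | no _ = refl

upd-true : ∀ {k} (f : Fin k → Bool) i j → f j ≡ true → upd f i true j ≡ true
upd-true f i j e with j ≟ᶠ i
... | yes _ = refl
... | no _ = e

_∈?_ : ∀ {n} (v : Fin n) vs → Dec (v ∈ vs)
_∈?_ = DecMembership._∈?_ _≟ᶠ_

true≢false : true ≢ false
true≢false ()

Unique-resp-↭ : ∀ {A : Set} {xs ys : List A} → xs ↭ ys → Unique xs → Unique ys
Unique-resp-↭ {A} p = PermutationSetoid.Unique-resp-↭ (setoid A) (↭⇒↭ₛ p)

Unique-++⁻ : ∀ {A : Set} (xs : List A) {ys} →
  Unique (xs ++ ys) → Unique xs × Unique ys × Disjoint xs ys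
Unique-++⁻ [] u = [] , u , λ { (() , _) }
Unique-++⁻ (x ∷ xs) (x∉ ∷ u) with Unique-++⁻ xs u
... | uxs , uys , disjoint =
  AllProps.++⁻ˡ xs x∉ ∷ uxs , uys ,
  λ { (here refl , m) → All.lookup (AllProps.++⁻ʳ xs x∉) m refl
    ; (there m₁ , m₂) → disjoint (m₁ , m₂) }

module _ {A : Set} where

  concatAll : ∀ {P} → (Fin P → List A) → List A
  concatAll {zero} f = []
  concatAll {suc P} f = f fzero ++ concatAll (λ i → f (fsuc i))

  concatAll-cong : ∀ {P} (f g : Fin P → List A) → (∀ i → f i ≡ g i) → concatAll f ≡ concatAll g
  concatAll-cong {zero} f g e = refl
  concatAll-cong {suc P} f g e = cong₂ _++_ (e fzero) (concatAll-cong _ _ (λ i → e (fsuc i)))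

  concatAll-[] : ∀ {P} → concatAll {P} (λ _ → []) ≡ []
  concatAll-[] {zero} = refl
  concatAll-[] {suc P} = concatAll-[] {P}

  concatAll-focus : ∀ {P} (f g : Fin P → List A) (p : Fin P) → (∀ r → r ≢ p → f r ≡ g r) →
    ∃ λ R → (concatAll f ↭ f p ++ R) × (concatAll g ↭ g p ++ R)
  concatAll-focus {suc P} f g fzero e =
    concatAll (λ i → f (fsuc i)) , ↭-refl ,
    ↭-reflexive (cong (g fzero ++_) (sym (concatAll-cong _ _ (λ i → e (fsuc i) (λ ())))))
  concatAll-focus {suc P} f g (fsuc p) e
    with concatAll-focus (λ i → f (fsuc i)) (λ i → g (fsuc i)) p
           (λ r r≢p → e (fsuc r) (λ eq → r≢p (suc-injective eq)))
  ... | R , f↭ , g↭ =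
    f fzero ++ R ,
    ↭-trans (++⁺ˡ (f fzero) f↭) (shifts (f fzero) (f (fsuc p))) ,
    ↭-trans (↭-reflexive (cong (_++ concatAll (λ i → g (fsuc i))) (sym (e fzero (λ ())))))
            (↭-trans (++⁺ˡ (f fzero) g↭) (shifts (f fzero) (g (fsuc p))))

  ∈-concatAll : ∀ {P} (f : Fin P → List A) (p : Fin P) {x} → x ∈ f p → x ∈ concatAll f
  ∈-concatAll {suc P} f fzero m = ∈-++⁺ˡ m
  ∈-concatAll {suc P} f (fsuc p) m = ∈-++⁺ʳ (f fzero) (∈-concatAll (λ i → f (fsuc i)) p m)

  concatAll-unique-part : ∀ {P} (f : Fin P → List A) (p : Fin P) →
    Unique (concatAll f) → Unique (f p)
  concatAll-unique-part {suc P} f fzero u = proj₁ (Unique-++⁻ (f fzero) u)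
  concatAll-unique-part {suc P} f (fsuc p) u =
    concatAll-unique-part (λ i → f (fsuc i)) p (proj₁ (proj₂ (Unique-++⁻ (f fzero) u)))

  concatAll-disjoint-parts : ∀ {P} (f : Fin P → List A) (p q : Fin P) {x} →
    Unique (concatAll f) → p ≢ q → x ∈ f p → x ∈ f q → ⊥
  concatAll-disjoint-parts {suc P} f fzero fzero u p≢q _ _ = p≢q refl
  concatAll-disjoint-parts {suc P} f fzero (fsuc q) u _ m₁ m₂ =
    proj₂ (proj₂ (Unique-++⁻ (f fzero) u)) (m₁ , ∈-concatAll (λ i → f (fsuc i)) q m₂)
  concatAll-disjoint-parts {suc P} f (fsuc p) fzero u _ m₁ m₂ =
    proj₂ (proj₂ (Unique-++⁻ (f fzero) u)) (m₂ , ∈-concatAll (λ i → f (fsuc i)) p m₁)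
  concatAll-disjoint-parts {suc P} f (fsuc p) (fsuc q) u p≢q m₁ m₂ =
    concatAll-disjoint-parts (λ i → f (fsuc i)) p q (proj₁ (proj₂ (Unique-++⁻ (f fzero) u)))
      (λ e → p≢q (cong fsuc e)) m₁ m₂

  top-to-front : ∀ (a b : List A) {xs x} → a ++ b ++ (xs ∷ʳ x) ↭ x ∷ a ++ b ++ xs
  top-to-front a b {xs} {x} = ↭-trans (↭-reflexive reassoc) (↭-sym (∷↭∷ʳ x (a ++ b ++ xs)))
    where
    reassoc : a ++ b ++ (xs ++ [ x ]) ≡ (a ++ b ++ xs) ++ [ x ]
    reassoc = trans (cong (a ++_) (sym (++-assoc b xs [ x ]))) (sym (++-assoc a (b ++ xs) [ x ]))

  concatAll-resp-part : ∀ {P} (f g : Fin P → List A) (p : Fin P) →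
    (∀ r → r ≢ p → f r ≡ g r) → f p ↭ g p → concatAll f ↭ concatAll g
  concatAll-resp-part f g p same f↭g with concatAll-focus f g p same
  ... | R , f-focus , g-focus = ↭-trans f-focus (↭-trans (++⁺ʳ R f↭g) (↭-sym g-focus))

  concatAll-move : ∀ {P} (f g : Fin P → List A) (p q : Fin P) x → p ≢ q →
    (∀ r → r ≢ p → r ≢ q → f r ≡ g r) → g p ≡ x ∷ f p → f q ↭ x ∷ g q →
    concatAll g ↭ concatAll f
  concatAll-move f g p q x p≢q same gp fq
    with concatAll-focus f mid q (λ r r≢q → sym (upd-neq f q (g q) r r≢q))
       | concatAll-focus mid g p mid≡g
    where
    mid = upd f q (g q)
    mid≡g : ∀ r → r ≢ p → mid r ≡ g r
    mid≡g r r≢p with r ≟ᶠ q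
    ... | yes refl = refl
    ... | no r≢q = same r r≢p r≢q
  ... | R₁ , f-focus , mid-focus₁ | R₂ , mid-focus₂ , g-focus = begin
    concatAll g                 ↭⟨ g-focus ⟩
    g p ++ R₂                   ≡⟨ cong (_++ R₂) gp ⟩
    x ∷ f p ++ R₂               ≡⟨ cong (λ l → x ∷ l ++ R₂) (sym (upd-neq f q (g q) p p≢q)) ⟩
    x ∷ upd f q (g q) p ++ R₂   ↭⟨ prep x (↭-sym mid-focus₂) ⟩
    x ∷ concatAll (upd f q (g q)) ↭⟨ prep x mid-focus₁ ⟩
    x ∷ upd f q (g q) q ++ R₁   ≡⟨ cong (λ l → x ∷ l ++ R₁) (upd-eq f q (g q)) ⟩
    x ∷ g q ++ R₁               ↭⟨ ++⁺ʳ R₁ fq ⟨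
    f q ++ R₁                   ↭⟨ f-focus ⟨
    concatAll f                 ∎
    where open PermutationReasoning

module _ {n : ℕ} {Ch : Fin n → List (Fin n)} where

  path-++ : ∀ {a b c d k j} → Path Ch a b k → c ∈ Ch b → Path Ch c d j → Path Ch a d (k + j)
  path-++ here e q = edge e q
  path-++ (edge e' p) e q = edge e' (path-++ p e q)

  path-nonempty : ∀ {a b k} → Path Ch a b k → 1 ≤ k
  path-nonempty here = s≤s z≤n
  path-nonempty (edge _ _) = s≤s z≤n

  path-cases : ∀ {a b k} → Path Ch a b k → (a ≡ b) ⊎ Ancestor Ch a b
  path-cases here = inj₁ refl
  path-cases (edge {v = v} {k = k} e p) = inj₂ (v , k , e , p)

module _ {n : ℕ} (C : Computation n) where

  -- By acyclicity the root has no ancestor (every node is reachable from it).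
  root-has-no-ancestor : ∀ w → ¬ Ancestor (children C) w (root C)
  root-has-no-ancestor w (x , k , x∈w , x⇝root) with fromRoot C w
  ... | _ , root⇝w with path-cases root⇝w
  ... | inj₁ refl = acyclic C (root C) (x , k , x∈w , x⇝root)
  ... | inj₂ (y , j , y∈root , y⇝w) =
    acyclic C (root C) (y , j + k , y∈root , path-++ y⇝w x∈w x⇝root)

  -- Readiness is a conjunction of boolean equations, hence ¬¬-stable.
  Ready-stable : ∀ ex v → ¬ ¬ Ready C ex v → Ready C ex v
  Ready-stable ex v nn =
    decidable-stable (ex v ≟ᵇ false) (¬¬-map proj₁ nn) ,
    λ w anc → decidable-stable (ex w ≟ᵇ true) (¬¬-map (λ r → proj₂ r w anc) nn)

  Ready-resp : ∀ {f g : Fin n → Bool} {v} → (∀ w → f w ≡ g w) → Ready C f v → Ready C g v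
  Ready-resp {v = v} f≗g (unexec , anc) =
    trans (sym (f≗g v)) unexec , λ w a → trans (sym (f≗g w)) (anc w a)

  Ready-after-exec : ∀ ex u v → Ready C ex v → v ≢ u → Ready C (upd ex u true) v
  Ready-after-exec ex u v (unexec , anc) v≢u =
    trans (upd-neq ex u true v v≢u) unexec , λ w a → upd-true ex u w (anc w a)

  Ready-after-exec-or-self : ∀ ex u v → Ready C ex v → Ready C (upd ex u true) v ⊎ v ≡ u
  Ready-after-exec-or-self ex u v r = decide (v ≟ᶠ u)
    where
    decide : Dec (v ≡ u) → Ready C (upd ex u true) v ⊎ v ≡ u
    decide (yes v≡u) = inj₂ v≡u
    decide (no v≢u) = inj₁ (Ready-after-exec ex u v r v≢u)

  newly-ready-descends : ∀ ex u v → Ready C (upd ex u true) v → ¬ Ready C ex v →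
    ¬ ¬ Ancestor (children C) u v
  newly-ready-descends ex u v (unexec , anc) not-ready u-not-anc = not-ready (unexec₀ , anc₀)
    where
    v≢u : v ≢ u
    v≢u refl = true≢false (trans (sym (upd-eq ex u true)) unexec)
    unexec₀ : ex v ≡ false
    unexec₀ = trans (sym (upd-neq ex u true v v≢u)) unexec
    anc₀ : ∀ w → Ancestor (children C) w v → ex w ≡ true
    anc₀ w a with w ≟ᶠ u
    ... | yes refl = ⊥-elim (u-not-anc a)
    ... | no w≢u = trans (sym (upd-neq ex u true w w≢u)) (anc w a)

module _ {n P : ℕ} where

  slot : State n P → Fin P → List (Fin n)
  slot s p = fromMaybe (assigned s p) ++ priv s p ++ pub s p

  held : State n P → List (Fin n)
  held s = concatAll (slot s)

  data FirstAssigned (next : Maybe (Fin n)) : List (Fin n) → Set where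
    none : FirstAssigned next []
    one  : ∀ {a} → next ≡ just a → FirstAssigned next (a ∷ [])
    two  : ∀ {a b} → next ≡ just a → FirstAssigned next (a ∷ b ∷ [])

  -- The enabled nodes are the new assigned node a and at most one other node b
  -- (a and b are arbitrary, e.g. a default node, when nothing is enabled).
  first-assigned-split : ∀ {next en} → Fin n → FirstAssigned next en →
    Σ (Fin n) λ a → Σ (Fin n) λ b → ∀ v → v ∈ en → (v ≡ a × next ≡ just v) ⊎ v ≡ b
  first-assigned-split x none = x , x , λ _ ()
  first-assigned-split _ (one {a} next≡a) = a , a , λ { v (here refl) → inj₁ (refl , next≡a) }
  first-assigned-split _ (two {a} {b} next≡a) =
    a , b , λ { v (here refl) → inj₁ (refl , next≡a) ; v (there (here refl)) → inj₂ refl }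

  module _ (C : Computation n) where

    DepthWitnessed : State n P → Fin n → Set
    DepthWitnessed s v =
      ¬ ¬ (∃ λ k → Path (children C) (root C) v k × suc (depth s v) ≤ k)

    record Inv (s : State n P) : Set where
      field
        held-unique      : Unique (held s)
        held-ready       : All (Ready C (executed s)) (held s)
        dparent-executed : ∀ v w → dparent s v ≡ just w → executed s w ≡ true
        depth-witnessed  : ∀ v → Ready C (executed s) v → DepthWitnessed s v
    open Inv public

    record Execution (p : Fin P) (s s' : State n P) : Set where
      field
        node           : Fin n
        enabled        : List (Fin n)
        rest           : List (Fin n)
        was-assigned   : assigned s p ≡ just node
        enabled-by     : EnabledBy C s node enabled
        slot-before    : slot s p ≡ node ∷ rest
        slot-after     : slot s' p ≡ enabled ++ rest
        other-slots    : ∀ r → r ≢ p → slot s' r ≡ slot s r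
        other-assigned : ∀ r → r ≢ p → assigned s' r ≡ assigned s r
        executed-after : ∀ v → executed s' v ≡ upd (executed s) node true v
        untouched      : ∀ v → v ∉ enabled → dparent s' v ≡ dparent s v × depth s' v ≡ depth s v
        enabled-child  : ∀ v → v ∈ enabled →
                           dparent s' v ≡ just node × depth s' v ≡ suc (depth s node)
        placement      : FirstAssigned (assigned s' p) enabled

    record Bookkeeping (s s' : State n P) : Set where
      field
        same-executed  : ∀ v → executed s' v ≡ executed s v
        same-dparent   : ∀ v → dparent s' v ≡ dparent s v
        same-depth     : ∀ v → depth s' v ≡ depth s v
        held-permuted  : held s' ↭ held s
        keeps-assigned : ∀ r v → assigned s r ≡ just v → assigned s' r ≡ just v

    data ActEffect (p : Fin P) (s s' : State n P) : Set where
      executes  : Execution p s s' → ActEffect p s s'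
      bookkeeps : Bookkeeping s s' → ActEffect p s s'

    steal-permutes : ∀ {s} p q xs x → assigned s p ≡ nothing → pub s q ≡ xs ∷ʳ x →
      held (record s { pub = upd (pub s) q xs ; assigned = upd (assigned s) p (just x) }) ↭ held s
    steal-permutes {s} p q xs x p-idle q-top with q ≟ᶠ p
    ... | yes refl = concatAll-resp-part (slot s') (slot s) p same (↭-sym robbed)
      where
      s' = record s { pub = upd (pub s) q xs ; assigned = upd (assigned s) p (just x) }
      same : ∀ r → r ≢ p → slot s' r ≡ slot s r
      same r r≢p rewrite upd-neq (assigned s) p (just x) r r≢p | upd-neq (pub s) p xs r r≢p = refl
      robbed : slot s p ↭ slot s' p
      robbed rewrite upd-eq (assigned s) p (just x) | upd-eq (pub s) p xs | p-idle | q-top =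
        top-to-front [] (priv s p)
    ... | no q≢p = concatAll-move (slot s) (slot s') p q x (λ e → q≢p (sym e)) same thief robbed
      where
      s' = record s { pub = upd (pub s) q xs ; assigned = upd (assigned s) p (just x) }
      same : ∀ r → r ≢ p → r ≢ q → slot s r ≡ slot s' r
      same r r≢p r≢q rewrite upd-neq (assigned s) p (just x) r r≢p | upd-neq (pub s) q xs r r≢q = refl
      thief : slot s' p ≡ x ∷ slot s p
      thief rewrite upd-eq (assigned s) p (just x) | upd-neq (pub s) q xs p (λ e → q≢p (sym e)) | p-idle =
        refl
      robbed : slot s q ↭ x ∷ slot s' q
      robbed rewrite upd-neq (assigned s) p (just x) q q≢p | upd-eq (pub s) q xs | q-top =
        top-to-front (fromMaybe (assigned s q)) (priv s q)

    act-effect : ∀ {p s s'} → Act C p s s' → ActEffect p s s'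
    act-effect {p} {s} {s'} (execNonePriv u x xs was ena p-priv) = executes record
      { node = u ; enabled = [] ; rest = x ∷ xs ++ pub s p ; was-assigned = was ; enabled-by = ena
      ; slot-before = before ; slot-after = after ; other-slots = others
      ; other-assigned = upd-neq (assigned s) p (just x)
      ; executed-after = λ _ → refl ; untouched = λ _ _ → refl , refl ; enabled-child = λ _ ()
      ; placement = none }
      where
      before : slot s p ≡ u ∷ x ∷ xs ++ pub s p
      before rewrite was | p-priv = refl
      after : slot s' p ≡ x ∷ xs ++ pub s p
      after rewrite upd-eq (assigned s) p (just x) | upd-eq (priv s) p xs = refl
      others : ∀ r → r ≢ p → slot s' r ≡ slot s r
      others r r≢p rewrite upd-neq (assigned s) p (just x) r r≢p | upd-neq (priv s) p xs r r≢p = refl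
    act-effect {p} {s} {s'} (execNonePub u x xs was ena p-priv p-pub) = executes record
      { node = u ; enabled = [] ; rest = x ∷ xs ; was-assigned = was ; enabled-by = ena
      ; slot-before = before ; slot-after = after ; other-slots = others
      ; other-assigned = upd-neq (assigned s) p (just x)
      ; executed-after = λ _ → refl ; untouched = λ _ _ → refl , refl ; enabled-child = λ _ ()
      ; placement = none }
      where
      before : slot s p ≡ u ∷ x ∷ xs
      before rewrite was | p-pub = cong (λ l → u ∷ l ++ x ∷ xs) p-priv
      after : slot s' p ≡ x ∷ xs
      after rewrite upd-eq (assigned s) p (just x) | upd-eq (pub s) p xs = cong (λ l → x ∷ l ++ xs) p-priv
      others : ∀ r → r ≢ p → slot s' r ≡ slot s r
      others r r≢p rewrite upd-neq (assigned s) p (just x) r r≢p | upd-neq (pub s) p xs r r≢p = refl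
    act-effect {p} {s} {s'} (execNoneIdle u was ena p-priv p-pub) = executes record
      { node = u ; enabled = [] ; rest = [] ; was-assigned = was ; enabled-by = ena
      ; slot-before = before ; slot-after = after ; other-slots = others
      ; other-assigned = upd-neq (assigned s) p nothing
      ; executed-after = λ _ → refl ; untouched = λ _ _ → refl , refl ; enabled-child = λ _ ()
      ; placement = none }
      where
      before : slot s p ≡ u ∷ []
      before rewrite was = cong₂ (λ a b → u ∷ a ++ b) p-priv p-pub
      after : slot s' p ≡ []
      after rewrite upd-eq (assigned s) p nothing = cong₂ _++_ p-priv p-pub
      others : ∀ r → r ≢ p → slot s' r ≡ slot s r
      others r r≢p rewrite upd-neq (assigned s) p nothing r r≢p = refl
    act-effect {p} {s} {s'} (execOne u v was ena) = executes record
      { node = u ; enabled = v ∷ [] ; rest = priv s p ++ pub s p ; was-assigned = was ; enabled-by = ena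
      ; slot-before = before ; slot-after = after ; other-slots = others
      ; other-assigned = upd-neq (assigned s) p (just v)
      ; executed-after = λ _ → refl ; untouched = untouched ; enabled-child = child
      ; placement = one (upd-eq (assigned s) p (just v)) }
      where
      before : slot s p ≡ u ∷ priv s p ++ pub s p
      before rewrite was = refl
      after : slot s' p ≡ v ∷ priv s p ++ pub s p
      after rewrite upd-eq (assigned s) p (just v) = refl
      others : ∀ r → r ≢ p → slot s' r ≡ slot s r
      others r r≢p rewrite upd-neq (assigned s) p (just v) r r≢p = refl
      untouched : ∀ w → w ∉ v ∷ [] → dparent s' w ≡ dparent s w × depth s' w ≡ depth s w
      untouched w w∉ = upd-neq (dparent s) v _ w w≢v , upd-neq (depth s) v _ w w≢v
        where
        w≢v : w ≢ v
        w≢v e = w∉ (here e)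
      child : ∀ w → w ∈ v ∷ [] → dparent s' w ≡ just u × depth s' w ≡ suc (depth s u)
      child w (here refl) = upd-eq (dparent s) v _ , upd-eq (depth s) v _
    act-effect {p} {s} {s'} (execTwo u v₁ v₂ was ena) = executes record
      { node = u ; enabled = v₁ ∷ v₂ ∷ [] ; rest = priv s p ++ pub s p ; was-assigned = was
      ; enabled-by = ena ; slot-before = before ; slot-after = after ; other-slots = others
      ; other-assigned = upd-neq (assigned s) p (just v₁)
      ; executed-after = λ _ → refl ; untouched = untouched ; enabled-child = child
      ; placement = two (upd-eq (assigned s) p (just v₁)) }
      where
      d = suc (depth s u)
      v₁≢v₂ : v₁ ≢ v₂
      v₁≢v₂ with proj₁ ena
      ... | (v₁≢ ∷ _) ∷ _ = v₁≢
      before : slot s p ≡ u ∷ priv s p ++ pub s p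
      before rewrite was = refl
      after : slot s' p ≡ v₁ ∷ v₂ ∷ priv s p ++ pub s p
      after rewrite upd-eq (assigned s) p (just v₁) | upd-eq (priv s) p (v₂ ∷ priv s p) = refl
      others : ∀ r → r ≢ p → slot s' r ≡ slot s r
      others r r≢p rewrite upd-neq (assigned s) p (just v₁) r r≢p | upd-neq (priv s) p (v₂ ∷ priv s p) r r≢p =
        refl
      untouched : ∀ w → w ∉ v₁ ∷ v₂ ∷ [] →
        dparent s' w ≡ dparent s w × depth s' w ≡ depth s w
      untouched w w∉ =
        trans (upd-neq (upd (dparent s) v₁ (just u)) v₂ _ w w≢v₂)
              (upd-neq (dparent s) v₁ _ w w≢v₁) ,
        trans (upd-neq (upd (depth s) v₁ d) v₂ _ w w≢v₂) (upd-neq (depth s) v₁ _ w w≢v₁)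
        where
        w≢v₁ : w ≢ v₁
        w≢v₁ e = w∉ (here e)
        w≢v₂ : w ≢ v₂
        w≢v₂ e = w∉ (there (here e))
      child : ∀ w → w ∈ v₁ ∷ v₂ ∷ [] → dparent s' w ≡ just u × depth s' w ≡ d
      child w (here refl) =
        trans (upd-neq (upd (dparent s) v₁ (just u)) v₂ _ w v₁≢v₂) (upd-eq (dparent s) v₁ _) ,
        trans (upd-neq (upd (depth s) v₁ d) v₂ _ w v₁≢v₂) (upd-eq (depth s) v₁ _)
      child w (there (here refl)) =
        upd-eq (upd (dparent s) v₁ (just u)) v₂ _ , upd-eq (upd (depth s) v₁ d) v₂ _
    act-effect {p} {s} (stealOk q xs x p-idle q-top) = bookkeeps record
      { same-executed = λ _ → refl ; same-dparent = λ _ → refl ; same-depth = λ _ → refl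
      ; held-permuted = steal-permutes {s} p q xs x p-idle q-top ; keeps-assigned = keeps }
      where
      keeps : ∀ r v → assigned s r ≡ just v → upd (assigned s) p (just x) r ≡ just v
      keeps r v e = decide (r ≟ᶠ p)
        where
        decide : Dec (r ≡ p) → upd (assigned s) p (just x) r ≡ just v
        decide (yes refl) with () ← trans (sym p-idle) e
        decide (no r≢p) = trans (upd-neq (assigned s) p _ r r≢p) e
    act-effect (stealFail q _ _) = bookkeeps record
      { same-executed = λ _ → refl ; same-dparent = λ _ → refl ; same-depth = λ _ → refl
      ; held-permuted = ↭-refl ; keeps-assigned = λ _ _ e → e }

    -- Retargeting moves a node from the private to the public part of the
    -- same slot, leaving the held list unchanged.
    inv-retarget : ∀ {p s s₁} → Retarget C p s s₁ → Inv s → Inv s₁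
    inv-retarget (notTargeted _) inv = inv
    inv-retarget (targetedEmpty _ _) inv = record
      { held-unique = held-unique inv ; held-ready = held-ready inv
      ; dparent-executed = dparent-executed inv ; depth-witnessed = depth-witnessed inv }
    inv-retarget {p} {s} (targetedMove xs x _ p-priv) inv = record
      { held-unique = subst Unique (sym same-held) (held-unique inv)
      ; held-ready = subst (All _) (sym same-held) (held-ready inv)
      ; dparent-executed = dparent-executed inv ; depth-witnessed = depth-witnessed inv }
      where
      s₁ = record s { targeted = upd (targeted s) p false ; priv = upd (priv s) p xs
                    ; pub = upd (pub s) p (x ∷ pub s p) }
      same-slot : ∀ q → Dec (q ≡ p) → slot s₁ q ≡ slot s q
      same-slot q (yes refl) rewrite upd-eq (priv s) q xs | upd-eq (pub s) q (x ∷ pub s q) | p-priv =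
        cong (fromMaybe (assigned s q) ++_) (sym (++-assoc xs [ x ] (pub s q)))
      same-slot q (no q≢p) rewrite upd-neq (priv s) p xs q q≢p | upd-neq (pub s) p (x ∷ pub s p) q q≢p =
        refl
      same-held : held s₁ ≡ held s
      same-held = concatAll-cong _ _ (λ q → same-slot q (q ≟ᶠ p))

    DepthWitnessed-resp : ∀ {s s'} v → depth s' v ≡ depth s v →
      DepthWitnessed s v → DepthWitnessed s' v
    DepthWitnessed-resp v same =
      ¬¬-map λ { (k , path , bound) → k , path , subst (λ d → suc d ≤ k) (sym same) bound }

    -- A child in the enabling tree extends a root path of its parent.
    DepthWitnessed-child : ∀ {s s'} u v → DepthWitnessed s u → ¬ ¬ Ancestor (children C) u v →
      depth s' v ≡ suc (depth s u) → DepthWitnessed s' v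
    DepthWitnessed-child u v witnessed descends child-depth stuck =
      witnessed λ { (k , root⇝u , bound) → descends λ { (y , j , y∈u , y⇝v) →
        stuck (k + j , path-++ root⇝u y∈u y⇝v ,
               subst (λ d → suc d ≤ k + j) (sym child-depth)
                 (subst (_≤ k + j) (+-comm _ 1) (+-mono-≤ bound (path-nonempty y⇝v)))) } }

    -- Non-executing actions only permute the held nodes.
    inv-bookkeeping : ∀ {s s'} → Bookkeeping s s' → Inv s → Inv s'
    inv-bookkeeping {s} {s'} b inv = record
      { held-unique = Unique-resp-↭ (↭-sym held-permuted) (held-unique inv)
      ; held-ready = All.map (Ready-resp C (λ v → sym (same-executed v)))
                       (All-resp-↭ (↭-sym held-permuted) (held-ready inv))
      ; dparent-executed = λ v w e →
          trans (same-executed w) (dparent-executed inv v w (trans (sym (same-dparent v)) e))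
      ; depth-witnessed = λ v r →
          DepthWitnessed-resp {s} {s'} v (same-depth v) (depth-witnessed inv v (Ready-resp C same-executed r)) }
      where open Bookkeeping b

    module _ {p : Fin P} {s s' : State n P} (e : Execution p s s') where
      open Execution e

      execution-held : ∃ λ M → (held s ↭ node ∷ M) × (held s' ↭ enabled ++ M)
      execution-held with concatAll-focus (slot s) (slot s') p (λ r r≢p → sym (other-slots r r≢p))
      ... | R , before , after =
        rest ++ R ,
        ↭-trans before (↭-reflexive (cong (_++ R) slot-before)) ,
        ↭-trans after (↭-reflexive (trans (cong (_++ R) slot-after) (++-assoc enabled rest R)))

      newly-ready : ∀ v → v ∈ enabled →
        ¬ Ready C (executed s) v × Ready C (upd (executed s) node true) v
      newly-ready v = Equivalence.to (proj₂ enabled-by v)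

      ready-before : ∀ v → v ∉ enabled → Ready C (executed s') v → Ready C (executed s) v
      ready-before v v∉ r = Ready-stable C (executed s) v λ not-ready →
        v∉ (Equivalence.from (proj₂ enabled-by v) (not-ready , Ready-resp C executed-after r))

      execution-dparent : Inv s → ∀ v w → dparent s' v ≡ just w → executed s' w ≡ true
      execution-dparent inv v w dp with v ∈? enabled
      ... | yes v∈ with refl ← just-injective (trans (sym (proj₁ (enabled-child v v∈))) dp) =
        trans (executed-after node) (upd-eq (executed s) node true)
      ... | no v∉ = trans (executed-after w)
        (upd-true (executed s) node w (dparent-executed inv v w (trans (sym (proj₁ (untouched v v∉))) dp)))

      execution-depth : Inv s → Ready C (executed s) node →
        ∀ v → Ready C (executed s') v → DepthWitnessed s' v
      execution-depth inv node-ready v r with v ∈? enabled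
      ... | yes v∈ = DepthWitnessed-child {s} {s'} node v (depth-witnessed inv node node-ready)
          (newly-ready-descends C (executed s) node v
            (proj₂ (newly-ready v v∈)) (proj₁ (newly-ready v v∈)))
          (proj₂ (enabled-child v v∈))
      ... | no v∉ = DepthWitnessed-resp {s} {s'} v (proj₂ (untouched v v∉))
          (depth-witnessed inv v (ready-before v v∉ r))

      inv-execution : Inv s → Inv s'
      inv-execution inv with execution-held
      ... | M , before , after = record
        { held-unique = Unique-resp-↭ (↭-sym after)
            (UniqueProps.++⁺ (proj₁ enabled-by) (AllPairs.tail unique₀)
              λ (m₁ , m₂) → proj₁ (newly-ready _ m₁) (All.lookup (All.tail ready₀) m₂))
        ; held-ready = All.map (Ready-resp C (λ v → sym (executed-after v))) (All-resp-↭ (↭-sym after)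
            (AllProps.++⁺ (All.tabulate λ {v} m → proj₂ (newly-ready v m)) (All.tabulate still-ready)))
        ; dparent-executed = execution-dparent inv
        ; depth-witnessed = execution-depth inv (All.head ready₀) }
        where
        unique₀ : Unique (node ∷ M)
        unique₀ = Unique-resp-↭ before (held-unique inv)
        ready₀ : All (Ready C (executed s)) (node ∷ M)
        ready₀ = All-resp-↭ before (held-ready inv)
        still-ready : ∀ {y} → y ∈ M → Ready C (upd (executed s) node true) y
        still-ready {y} m = Ready-after-exec C (executed s) node y (All.lookup (All.tail ready₀) m)
          λ { refl → UniqueProps.Unique[x∷xs]⇒x∉xs unique₀ m }

    inv-act : ∀ {p s s'} → Act C p s s' → Inv s → Inv s'
    inv-act a with act-effect a
    ... | executes e = inv-execution e
    ... | bookkeeps b = inv-bookkeeping b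

    inv-iter : ∀ {p s s'} → Iter C p s s' → Inv s → Inv s'
    inv-iter (_ , retarget , a) inv = inv-act a (inv-retarget retarget inv)

    inv-iters : ∀ {ps s s'} → Iters C ps s s' → Inv s → Inv s'
    inv-iters done inv = inv
    inv-iters (next it its) inv = inv-iters its (inv-iter it inv)

    -- Initially only the root is held, by p₀, and it has depth 0.
    inv-initial : ∀ {s} → Initial C s → Inv s
    inv-initial {s} (p₀ , unexecuted , no-dparent , root-depth , no-priv , no-pub , _ , p₀-root , idle) =
      record
      { held-unique = Unique-resp-↭ (↭-sym just-root) ([] ∷ [])
      ; held-ready = All-resp-↭ (↭-sym just-root) (root-ready ∷ [])
      ; dparent-executed = λ v w dp → ⊥-elim (nothing≢just (trans (sym (no-dparent v)) dp))
      ; depth-witnessed = witnessed }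
      where
      nothing≢just : ∀ {w : Fin n} → nothing ≢ just w
      nothing≢just ()
      root-ready : Ready C (executed s) (root C)
      root-ready = unexecuted (root C) , λ w anc → ⊥-elim (root-has-no-ancestor C w anc)
      others-empty : ∀ r → r ≢ p₀ → slot s r ≡ []
      others-empty r r≢p₀ rewrite idle r r≢p₀ | no-priv r | no-pub r = refl
      just-root : held s ↭ root C ∷ []
      just-root with concatAll-focus (slot s) (λ _ → []) p₀ others-empty
      ... | R , focus , empty-focus =
        ↭-trans focus (↭-trans (↭-reflexive (cong (_++ R) root-slot))
          (prep (root C) (↭-trans (↭-sym empty-focus) (↭-reflexive (concatAll-[] {P = P})))))
        where
        root-slot : slot s p₀ ≡ root C ∷ []
        root-slot rewrite p₀-root | no-priv p₀ | no-pub p₀ = refl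
      witnessed : ∀ v → Ready C (executed s) v → DepthWitnessed s v
      witnessed v r with fromRoot C v
      ... | k , root⇝v with path-cases root⇝v
      ... | inj₁ refl = λ stuck → stuck (1 , here , s≤s (subst (_≤ 0) (sym root-depth) z≤n))
      ... | inj₂ anc = ⊥-elim (true≢false (trans (sym (proj₂ r (root C) anc)) (unexecuted (root C))))

    reachable-inv : ∀ {s} → Reachable C s → Inv s
    reachable-inv (init initial) = inv-initial initial
    reachable-inv (step r (_ , _ , its)) = inv-iters its (reachable-inv r)

    slot-ready : ∀ {s r x} → Inv s → x ∈ slot s r → Ready C (executed s) x
    slot-ready {s} {r} inv x∈ = All.lookup (held-ready inv) (∈-concatAll (slot s) r x∈)

    assigned-ready : ∀ {s r x} → Inv s → assigned s r ≡ just x → Ready C (executed s) x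
    assigned-ready {s} {r} {x} inv e =
      slot-ready inv (subst (λ a → x ∈ fromMaybe a ++ priv s r ++ pub s r) (sym e) (here refl))

    stealable-ready : ∀ {s x} → Inv s → Stealable s x → Ready C (executed s) x
    stealable-ready {s} inv (r , x∈pub) =
      slot-ready inv (∈-++⁺ʳ (fromMaybe (assigned s r)) (∈-++⁺ʳ (priv s r) x∈pub))

    assigned-not-stealable : ∀ {s u} → Inv s → Assigned s u → ¬ Stealable s u
    assigned-not-stealable {s} {u} inv (p , p-has-u) (q , u∈pub) with q ≟ᶠ p
    ... | yes refl = UniqueProps.Unique[x∷xs]⇒x∉xs unique-slot (∈-++⁺ʳ (priv s q) u∈pub)
      where
      unique-slot : Unique (u ∷ priv s q ++ pub s q)
      unique-slot = subst Unique (cong (λ a → fromMaybe a ++ priv s q ++ pub s q) p-has-u)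
        (concatAll-unique-part (slot s) q (held-unique inv))
    ... | no q≢p = concatAll-disjoint-parts (slot s) p q (held-unique inv) (λ e → q≢p (sym e))
        (subst (λ a → u ∈ fromMaybe a ++ priv s p ++ pub s p) (sym p-has-u) (here refl))
        (∈-++⁺ʳ (fromMaybe (assigned s q)) (∈-++⁺ʳ (priv s q) u∈pub))

    -- In a reachable state a ready node ends a root path, so its depth is
    -- below the span T.
    depth-bound : ∀ {T s v} → IsSpan C T → Inv s → Ready C (executed s) v → suc (depth s v) ≤ T
    depth-bound {T} {s} {v} span inv r = decidable-stable (suc (depth s v) ≤? T)
      (¬¬-map (λ (k , path , bound) → ≤-trans bound (proj₂ span _ _ k path)) (depth-witnessed inv v r))

    DequeIndependent : (State n P → Set) → Set
    DequeIndependent Q = ∀ s tg pr pb → Q s → Q (record s { targeted = tg ; priv = pr ; pub = pb })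

    preserved : (Q : State n P → Set) → DequeIndependent Q →
      (∀ {p s s'} → Act C p s s' → Inv s → Q s → Q s') →
      ∀ {ps s s'} → Iters C ps s s' → Inv s → Q s → Q s'
    preserved Q independent by-act done inv q = q
    preserved Q independent by-act (next (_ , retarget , a) its) inv q =
      preserved Q independent by-act its (inv-act a inv₁) (by-act a inv₁ (by-retarget retarget q))
      where
      inv₁ = inv-retarget retarget inv
      by-retarget : ∀ {p s s₁} → Retarget C p s s₁ → Q s → Q s₁
      by-retarget (notTargeted _) q = q
      by-retarget {s = s} (targetedEmpty _ _) q = independent s _ (priv s) (pub s) q
      by-retarget {s = s} (targetedMove _ _ _ _) q = independent s _ _ _ q

    -- A node that is ready keeps its depth: it can only get executed, never
    -- re-enabled.
    SettledDepth : Fin n → ℕ → State n P → Set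
    SettledDepth u d t = (Ready C (executed t) u ⊎ executed t u ≡ true) × depth t u ≡ d

    settled-act : ∀ u d {p s s'} → Act C p s s' → Inv s → SettledDepth u d s → SettledDepth u d s'
    settled-act u d {s = s} {s'} a _ (status , u-depth) with act-effect a
    ... | bookkeeps b = status′ status , trans (same-depth u) u-depth
      where
      open Bookkeeping b
      status′ : Ready C (executed s) u ⊎ executed s u ≡ true →
        Ready C (executed s') u ⊎ executed s' u ≡ true
      status′ (inj₁ r) = inj₁ (Ready-resp C (λ v → sym (same-executed v)) r)
      status′ (inj₂ e) = inj₂ (trans (same-executed u) e)
    ... | executes e = status′ status , trans (proj₂ (untouched u (not-enabled status))) u-depth
      where
      open Execution e
      ex₀ = executed s
      status′ : Ready C ex₀ u ⊎ ex₀ u ≡ true → Ready C (executed s') u ⊎ executed s' u ≡ true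
      status′ (inj₂ was-executed) = inj₂ (trans (executed-after u) (upd-true ex₀ node u was-executed))
      status′ (inj₁ r) with Ready-after-exec-or-self C ex₀ node u r
      ... | inj₁ r′ = inj₁ (Ready-resp C (λ v → sym (executed-after v)) r′)
      ... | inj₂ refl = inj₂ (trans (executed-after u) (upd-eq ex₀ u true))
      not-enabled : Ready C ex₀ u ⊎ ex₀ u ≡ true → u ∉ enabled
      not-enabled st u∈ with newly-ready e u u∈ | st
      ... | not-ready , _ | inj₁ r = not-ready r
      ... | _ , r′ | inj₂ was-executed =
        true≢false (trans (sym (upd-true ex₀ node u was-executed)) (proj₁ r′))

    StaysAssigned : Fin n → Fin P → State n P → Set
    StaysAssigned u p₀ t = assigned t p₀ ≡ just u ⊎ executed t u ≡ true

    stays-assigned-act : ∀ u p₀ {p s s'} → Act C p s s' → Inv s →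
      StaysAssigned u p₀ s → StaysAssigned u p₀ s'
    stays-assigned-act u p₀ {s = s} a _ st with act-effect a | st
    ... | bookkeeps b | inj₁ assigned₀ = inj₁ (Bookkeeping.keeps-assigned b p₀ u assigned₀)
    ... | bookkeeps b | inj₂ was-executed = inj₂ (trans (Bookkeeping.same-executed b u) was-executed)
    ... | executes e | inj₂ was-executed =
      inj₂ (trans (executed-after u) (upd-true (executed s) node u was-executed))
      where open Execution e
    stays-assigned-act u p₀ {p} {s} a _ st | executes e | inj₁ assigned₀ with p₀ ≟ᶠ p
    ... | yes refl with refl ← just-injective (trans (sym (Execution.was-assigned e)) assigned₀) =
      inj₂ (trans (executed-after node) (upd-eq (executed s) node true))
      where open Execution e
    ... | no p₀≢p = inj₁ (trans (Execution.other-assigned e p₀ p₀≢p) assigned₀)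

    ChildrenPlaced : Fin n → ℕ → State n P → Fin n → Fin n → Set
    ChildrenPlaced u d t a b = ∀ v → Ready C (executed t) v → dparent t v ≡ just u →
      depth t v ≡ suc d × ((v ≡ a × Assigned t v) ⊎ v ≡ b)

    data Phase (u : Fin n) (d : ℕ) (t : State n P) : Set where
      waiting  : Assigned t u → executed t u ≡ false → depth t u ≡ d → Phase u d t
      finished : executed t u ≡ true → ∀ a b → ChildrenPlaced u d t a b → Phase u d t

    phase-independent : ∀ u d → DequeIndependent (Phase u d)
    phase-independent u d s tg pr pb (waiting assigned₀ unexec depth₀) = waiting assigned₀ unexec depth₀
    phase-independent u d s tg pr pb (finished exec a b placed) = finished exec a b placed

    phase-bookkeeping : ∀ {u d s s'} → Bookkeeping s s' → Phase u d s → Phase u d s'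
    phase-bookkeeping {u} b (waiting (r , r-has-u) unexec depth₀) =
      waiting (r , keeps-assigned r u r-has-u) (trans (same-executed u) unexec) (trans (same-depth u) depth₀)
      where open Bookkeeping b
    phase-bookkeeping {u} {d} {s} {s'} b (finished exec a c placed) =
      finished (trans (same-executed u) exec) a c placed′
      where
      open Bookkeeping b
      placed′ : ChildrenPlaced u d s' a c
      placed′ v r dp with placed v (Ready-resp C same-executed r) (trans (sym (same-dparent v)) dp)
      ... | depth₀ , inj₁ (refl , (q , q-has-v)) =
        trans (same-depth v) depth₀ , inj₁ (refl , q , keeps-assigned q v q-has-v)
      ... | depth₀ , inj₂ v≡c = trans (same-depth v) depth₀ , inj₂ v≡c

    module _ {p : Fin P} {s s' : State n P} (e : Execution p s s') where
      open Execution e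

      phase-execution-waiting : ∀ {u d} → Inv s →
        Assigned s u → executed s u ≡ false → depth s u ≡ d → Phase u d s'
      phase-execution-waiting {u} {d} inv (r , r-has-u) unexec depth₀ with node ≟ᶠ u
      ... | no node≢u = waiting (r , trans (other-assigned r r≢p) r-has-u)
          (trans (executed-after u)
                 (trans (upd-neq (executed s) node true u (λ eq → node≢u (sym eq))) unexec))
          (trans (proj₂ (untouched u u∉)) depth₀)
        where
        r≢p : r ≢ p
        r≢p refl = node≢u (just-injective (trans (sym was-assigned) r-has-u))
        u∉ : u ∉ enabled
        u∉ u∈ = proj₁ (newly-ready e u u∈) (assigned-ready inv r-has-u)
      ... | yes refl with first-assigned-split node placement
      ... | a , b , split = finished (trans (executed-after node) (upd-eq (executed s) node true)) a b placed
        where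
        child-depth : ∀ v → v ∈ enabled → depth s' v ≡ suc d
        child-depth v v∈ = trans (proj₂ (enabled-child v v∈)) (cong suc depth₀)
        placed : ChildrenPlaced node d s' a b
        placed v r dp with v ∈? enabled
        ... | no v∉ = ⊥-elim (true≢false (trans
              (sym (dparent-executed inv v node (trans (sym (proj₁ (untouched v v∉))) dp))) unexec))
        ... | yes v∈ with split v v∈
        ...   | inj₁ (refl , p-has-v) = child-depth v v∈ , inj₁ (refl , p , p-has-v)
        ...   | inj₂ v≡b = child-depth v v∈ , inj₂ v≡b

      phase-execution-finished : ∀ {u d} → Inv s →
        executed s u ≡ true → ∀ a b → ChildrenPlaced u d s a b → Phase u d s'
      phase-execution-finished {u} {d} inv exec a b placed =
        finished (trans (executed-after u) (upd-true (executed s) node u exec)) a b placed′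
        where
        keeps : ∀ {q v} → assigned s q ≡ just v → Ready C (executed s') v → assigned s' q ≡ just v
        keeps {q} q-has-v r with q ≟ᶠ p
        ... | no q≢p = trans (other-assigned q q≢p) q-has-v
        ... | yes refl with refl ← just-injective (trans (sym was-assigned) q-has-v) =
          ⊥-elim (true≢false (trans (sym (trans (executed-after node) (upd-eq (executed s) node true)))
                                    (proj₁ r)))
        placed′ : ChildrenPlaced u d s' a b
        placed′ v r dp with v ∈? enabled
        ... | yes v∈ with refl ← just-injective (trans (sym (proj₁ (enabled-child v v∈))) dp) =
          ⊥-elim (true≢false (trans (sym exec) (proj₁ (assigned-ready inv was-assigned))))
        ... | no v∉ with placed v (ready-before e v v∉ r) (trans (sym (proj₁ (untouched v v∉))) dp)
        ...   | depth₀ , inj₁ (refl , q , q-has-v) =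
          trans (proj₂ (untouched v v∉)) depth₀ , inj₁ (refl , q , keeps q-has-v r)
        ...   | depth₀ , inj₂ v≡b = trans (proj₂ (untouched v v∉)) depth₀ , inj₂ v≡b

    phase-act : ∀ u d {p s s'} → Act C p s s' → Inv s → Phase u d s → Phase u d s'
    phase-act u d a inv phase with act-effect a | phase
    ... | bookkeeps b | _ = phase-bookkeeping b phase
    ... | executes e | waiting assigned₀ unexec depth₀ =
      phase-execution-waiting e inv assigned₀ unexec depth₀
    ... | executes e | finished exec a′ b′ placed = phase-execution-finished e inv exec a′ b′ placed

module _ {n P : ℕ} (T : ℕ) (s : State n P) (u : Fin n) where
  private
    w = weight T s u

  phi-assigned : Assigned s u → phi T s u ≡ 4 ^ (3 * w ∸ 2)
  phi-assigned assigned₀ with assigned? s u | stealable? s u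
  ... | yes _ | _ = refl
  ... | no unassigned | _ = ⊥-elim (unassigned assigned₀)

  phi-unassigned : ¬ Assigned s u → 4 ^ (3 * w ∸ 1) ≤ phi T s u
  phi-unassigned unassigned with assigned? s u | stealable? s u
  ... | yes assigned₀ | _ = ⊥-elim (unassigned assigned₀)
  ... | no _ | yes _ = ≤-refl
  ... | no _ | no _ = ^-monoʳ-≤ 4 (m∸n≤m (3 * w) 1)

  phi-neither : ¬ Assigned s u → ¬ Stealable s u → phi T s u ≡ 4 ^ (3 * w)
  phi-neither unassigned unstealable with assigned? s u | stealable? s u
  ... | yes assigned₀ | _ = ⊥-elim (unassigned assigned₀)
  ... | no _ | yes stealable = ⊥-elim (unstealable stealable)
  ... | no _ | no _ = refl

  phi-stealable : Stealable s u → phi T s u ≤ 4 ^ (3 * w ∸ 1)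
  phi-stealable stealable with assigned? s u | stealable? s u
  ... | yes _ | _ = ^-monoʳ-≤ 4 (∸-monoʳ-≤ (3 * w) (s≤s z≤n))
  ... | no _ | yes _ = ≤-refl
  ... | no _ | no unstealable = ⊥-elim (unstealable stealable)

  phi-≤ : phi T s u ≤ 4 ^ (3 * w)
  phi-≤ with assigned? s u | stealable? s u
  ... | yes _ | _ = ^-monoʳ-≤ 4 (m∸n≤m (3 * w) 2)
  ... | no _ | yes _ = ^-monoʳ-≤ 4 (m∸n≤m (3 * w) 1)
  ... | no _ | no _ = ≤-refl

∸-suc-split : ∀ {d T} → suc d ≤ T → T ∸ d ≡ suc (T ∸ suc d)
∸-suc-split {zero} {suc T} _ = refl
∸-suc-split {suc d} {suc T} (s≤s d<T) = ∸-suc-split d<T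

level-step₁ : ∀ m → 4 * 4 ^ (3 * suc m ∸ 2) ≡ 4 ^ (3 * suc m ∸ 1)
level-step₁ m = subst (λ k → 4 * 4 ^ (k ∸ 2) ≡ 4 ^ (k ∸ 1)) (sym (*-suc 3 m)) refl

level-step₂ : ∀ m → 4 * 4 ^ (3 * suc m ∸ 1) ≡ 4 ^ (3 * suc m)
level-step₂ m = subst (λ k → 4 * 4 ^ (k ∸ 1) ≡ 4 ^ k) (sym (*-suc 3 m)) refl

-- Replacing a potential X by Y ≤ X/4 is a drop of at least 3X/4.
quarter-drop : ∀ X Y → 4 * Y ≤ X → 3 * X + 4 * Y ≤ 4 * X
quarter-drop X Y 4Y≤X = ≤-trans (+-monoʳ-≤ (3 * X) 4Y≤X) (≤-reflexive (three-plus-one X))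
  where
  three-plus-one : ∀ X → 3 * X + X ≡ 4 * X
  three-plus-one = solve-∀

-- Executing a node of weight m + 2 that was assigned, and replacing it by
-- children of weight m + 1 of total potential S, at most one assigned and
-- one arbitrary, is a drop of at least 47/64 of the node's potential.
execution-levels : ∀ m S → S ≤ 4 ^ (3 * suc m ∸ 2) + 4 ^ (3 * suc m) →
  47 * 4 ^ (3 * suc (suc m) ∸ 2) + 64 * S ≤ 64 * 4 ^ (3 * suc (suc m) ∸ 2)
execution-levels m S S≤ = subst (λ k → 47 * 4 ^ k + 64 * S ≤ 64 * 4 ^ k) (sym parent-level)
    (core (4 ^ (3 * m)) S (subst₂ (λ i j → S ≤ 4 ^ i + 4 ^ j) assigned-level free-level S≤))
  where
  free-level : 3 * suc m ≡ 3 + 3 * m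
  free-level = *-suc 3 m
  assigned-level : 3 * suc m ∸ 2 ≡ 1 + 3 * m
  assigned-level = cong (_∸ 2) free-level
  parent-level : 3 * suc (suc m) ∸ 2 ≡ 4 + 3 * m
  parent-level = cong (_∸ 2) (trans (*-suc 3 (suc m)) (cong (3 +_) free-level))
  -- 47·256 + 64·(4 + 64) = 64·256
  balance : ∀ X → 47 * (4 * (4 * (4 * (4 * X)))) + 64 * (4 * X + 4 * (4 * (4 * X)))
                ≡ 64 * (4 * (4 * (4 * (4 * X))))
  balance = solve-∀
  core : ∀ X S → S ≤ 4 * X + 4 * (4 * (4 * X)) →
    47 * (4 * (4 * (4 * (4 * X)))) + 64 * S ≤ 64 * (4 * (4 * (4 * (4 * X))))
  core X S S≤ =
    ≤-trans (+-monoʳ-≤ (47 * (4 * (4 * (4 * (4 * X))))) (*-monoʳ-≤ 64 S≤)) (≤-reflexive (balance X))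

module _ {A : Set} (f : A → ℕ) where

  sum-at-most-one : ∀ {a B} xs → Unique xs →
    (∀ v → v ∈ xs → v ≡ a × f v ≤ B) → sum (map f xs) ≤ B
  sum-at-most-one [] _ _ = z≤n
  sum-at-most-one (x ∷ []) _ only = ≤-trans (≤-reflexive (+-comm (f x) 0)) (proj₂ (only x (here refl)))
  sum-at-most-one (x ∷ y ∷ xs) ((x≢y ∷ _) ∷ _) only =
    ⊥-elim (x≢y (trans (proj₁ (only x (here refl))) (sym (proj₁ (only y (there (here refl)))))))

  sum-at-most-two : ∀ {a b A' B'} xs → Unique xs →
    (∀ v → v ∈ xs → (v ≡ a × f v ≤ A') ⊎ (v ≡ b × f v ≤ B')) → sum (map f xs) ≤ A' + B'
  sum-at-most-two [] _ _ = z≤n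
  sum-at-most-two {a} {b} {A'} {B'} (x ∷ xs) (x∉ ∷ unique) either with either x (here refl)
  ... | inj₁ (refl , fx≤) =
    +-mono-≤ fx≤ (sum-at-most-one xs unique λ v m → only-b v m (either v (there m)))
    where
    only-b : ∀ v → v ∈ xs → (v ≡ a × f v ≤ A') ⊎ (v ≡ b × f v ≤ B') → v ≡ b × f v ≤ B'
    only-b v m (inj₁ (refl , _)) = ⊥-elim (All.lookup x∉ m refl)
    only-b v m (inj₂ is-b) = is-b
  ... | inj₂ (refl , fx≤) =
    ≤-trans (+-mono-≤ fx≤ (sum-at-most-one xs unique λ v m → only-a v m (either v (there m))))
            (≤-reflexive (+-comm B' A'))
    where
    only-a : ∀ v → v ∈ xs → (v ≡ a × f v ≤ A') ⊎ (v ≡ b × f v ≤ B') → v ≡ a × f v ≤ A'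
    only-a v m (inj₁ is-a) = is-a
    only-a v m (inj₂ (refl , _)) = ⊥-elim (All.lookup x∉ m refl)

module Drops {n P : ℕ} (C : Computation n) (T : ℕ) (span : IsSpan C T)
             {ps : List (Fin P)} {s s' : State n P} (inv : Inv C s) (steps : Iters C ps s s')
             (u : Fin n) (ready-u : Ready C (executed s) u) where

  private
    d = depth s u
    m = T ∸ suc d

    inv' : Inv C s'
    inv' = inv-iters C steps inv

    weight-before : weight T s u ≡ suc m
    weight-before = ∸-suc-split (depth-bound C span inv ready-u)

    weight-after : weight T s' u ≡ suc m
    weight-after = trans (cong (T ∸_) (proj₂ settled)) weight-before
      where
      settled = preserved C (SettledDepth C u d) (λ _ _ _ _ q → q) (settled-act C u d)
                          steps inv (inj₁ ready-u , refl)

    phase-after : Assigned s u → Phase C u d s'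
    phase-after assigned₀ =
      preserved C (Phase C u d) (phase-independent C u d) (phase-act C u d)
                steps inv (waiting assigned₀ (proj₁ ready-u) refl)

  -- (1) u gets assigned: its potential level drops from 3w - 1 (or 3w) to 3w - 2.
  assignment-drop : ¬ Assigned s u → Assigned s' u → 3 * phi T s u + 4 * phi T s' u ≤ 4 * phi T s u
  assignment-drop unassigned assigned' = quarter-drop (phi T s u) (phi T s' u) (begin
    4 * phi T s' u                   ≡⟨ cong (4 *_) (phi-assigned T s' u assigned') ⟩
    4 * 4 ^ (3 * weight T s' u ∸ 2)  ≡⟨ cong (λ w → 4 * 4 ^ (3 * w ∸ 2)) weight-after ⟩
    4 * 4 ^ (3 * suc m ∸ 2)          ≡⟨ level-step₁ m ⟩
    4 ^ (3 * suc m ∸ 1)              ≡⟨ cong (λ w → 4 ^ (3 * w ∸ 1)) weight-before ⟨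
    4 ^ (3 * weight T s u ∸ 1)       ≤⟨ phi-unassigned T s u unassigned ⟩
    phi T s u                        ∎)
    where open ≤-Reasoning

  -- (2) u becomes stealable: it was neither assigned (an assigned node stays
  -- assigned or is executed) nor stealable, so its level drops from 3w to 3w - 1.
  stealable-drop : ¬ Stealable s u → Stealable s' u → 3 * phi T s u + 4 * phi T s' u ≤ 4 * phi T s u
  stealable-drop unstealable stealable' = quarter-drop (phi T s u) (phi T s' u) (begin
    4 * phi T s' u                   ≤⟨ *-monoʳ-≤ 4 (phi-stealable T s' u stealable') ⟩
    4 * 4 ^ (3 * weight T s' u ∸ 1)  ≡⟨ cong (λ w → 4 * 4 ^ (3 * w ∸ 1)) weight-after ⟩
    4 * 4 ^ (3 * suc m ∸ 1)          ≡⟨ level-step₂ m ⟩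
    4 ^ (3 * suc m)                  ≡⟨ cong (λ w → 4 ^ (3 * w)) weight-before ⟨
    4 ^ (3 * weight T s u)           ≡⟨ phi-neither T s u unassigned unstealable ⟨
    phi T s u                        ∎)
    where
    open ≤-Reasoning
    unassigned : ¬ Assigned s u
    unassigned (p₀ , p₀-has-u)
      with preserved C (StaysAssigned C u p₀) (λ _ _ _ _ q → q) (stays-assigned-act C u p₀)
                     steps inv (inj₁ p₀-has-u)
    ... | inj₁ still = assigned-not-stealable C inv' (p₀ , still) stealable'
    ... | inj₂ exec = true≢false (trans (sym exec) (proj₁ (stealable-ready C inv' stealable')))

  -- (3) u gets executed: its children have weight w - 1, at most one of
  -- them is assigned and at most one other is ready.
  execution-drop : Assigned s u → executed s' u ≡ true →
    (en : List (Fin n)) → Unique en →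
    (∀ v → v ∈ en ⇔ (Ready C (executed s') v × dparent s' v ≡ just u)) →
    47 * phi T s u + 64 * sum (map (phi T s') en) ≤ 64 * phi T s u
  execution-drop _ _ [] _ _ =
    ≤-trans (≤-reflexive (+-comm (47 * phi T s u) 0)) (*-monoˡ-≤ (phi T s u) (m≤m+n 47 17))
  execution-drop assigned₀ exec' en@(v₀ ∷ _) unique-en children with phase-after assigned₀
  ... | waiting _ unexec _ = ⊥-elim (true≢false (trans (sym exec') unexec))
  ... | finished _ a b placed = subst (λ X → 47 * X + 64 * sum (map (phi T s') en) ≤ 64 * X) (sym phi-u)
          (execution-levels m' _ (sum-at-most-two (phi T s') en unique-en child-potential))
    where
    child : ∀ v → v ∈ en → depth s' v ≡ suc d × ((v ≡ a × Assigned s' v) ⊎ v ≡ b)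
    child v v∈ = placed v (proj₁ ready-child) (proj₂ ready-child)
      where ready-child = Equivalence.to (children v) v∈
    -- a child exists, so u has weight at least 2
    m' = T ∸ suc (suc d)
    m≡ : m ≡ suc m'
    m≡ = ∸-suc-split (subst (λ k → suc k ≤ T) (proj₁ (child v₀ (here refl)))
                       (depth-bound C span inv' (proj₁ (Equivalence.to (children v₀) (here refl)))))
    phi-u : phi T s u ≡ 4 ^ (3 * suc (suc m') ∸ 2)
    phi-u = trans (phi-assigned T s u assigned₀)
                  (cong (λ w → 4 ^ (3 * w ∸ 2)) (trans weight-before (cong suc m≡)))
    child-weight : ∀ v → v ∈ en → weight T s' v ≡ suc m'
    child-weight v v∈ = trans (cong (T ∸_) (proj₁ (child v v∈))) m≡
    child-potential : ∀ v → v ∈ en →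
      (v ≡ a × phi T s' v ≤ 4 ^ (3 * suc m' ∸ 2)) ⊎ (v ≡ b × phi T s' v ≤ 4 ^ (3 * suc m'))
    child-potential v v∈ with child v v∈
    ... | _ , inj₁ (refl , assigned-v) = inj₁ (refl , ≤-reflexive
          (trans (phi-assigned T s' v assigned-v) (cong (λ w → 4 ^ (3 * w ∸ 2)) (child-weight v v∈))))
    ... | _ , inj₂ refl =
      inj₂ (refl , subst (λ w → phi T s' v ≤ 4 ^ (3 * w)) (child-weight v v∈) (phi-≤ T s' v))

lemma6 : ∀ {n P : ℕ} (C : Computation n) (T : ℕ) → IsSpan C T →
  (s s' : State n P) → Reachable C s → Step C s s' →
  (u : Fin n) → Ready C (executed s) u →
    (¬ Assigned s u → Assigned s' u →
       3 * phi T s u + 4 * phi T s' u ≤ 4 * phi T s u)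
  × (¬ Stealable s u → Stealable s' u →
       3 * phi T s u + 4 * phi T s' u ≤ 4 * phi T s u)
  × (Assigned s u → executed s' u ≡ true →
       (en : List (Fin n)) → Unique en →
       (∀ v → v ∈ en ⇔ (Ready C (executed s') v × dparent s' v ≡ just u)) →
       47 * phi T s u + 64 * sum (map (phi T s') en) ≤ 64 * phi T s u)
lemma6 C T span s s' reachable (_ , _ , steps) u ready-u =
  assignment-drop , stealable-drop , execution-drop
  where open Drops C T span (reachable-inv C reachable) steps u ready-u
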